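{- Let $\mathbb{N}_1,\mathbb{N}_2$ be countable infinite sets, $J$ an ideal on $\mathbb{N}_1$ and $K$ an ideal on $\mathbb{N}_2$. Then: (a) if $K\leq_{\mathrm{KB}}J$ then $\mathcal{N}^*_K\subseteq\mathcal{N}^*_J$ and $\mathcal{N}_J\subseteq\mathcal{N}_K$; (b) if $K\leq_{\overline{\mathrm{KB}}}J$ then $\mathcal{N}^*_K\subseteq\mathcal{N}^*_J$ and $\mathcal{N}_J\subseteq\mathcal{N}_K$; (c) if $K\leq_{\mathrm{RB}}J$ then $\mathcal{N}^*_J=\mathcal{N}^*_K$ and $\mathcal{N}_J=\mathcal{N}_K$.
   Context: An ideal on a countable infinite set $W$ is a family $J\subseteq\mathcal{P}(W)$ closed under subsets and finite unions, containing all finite subsets of $W$, with $W\notin J$; $J^+=\mathcal{P}(W)\setminus J$, $J^d=\{W\setminus a:a\in J\}$. ${}^\omega 2$ is the Cantor space with Lebesgue (product) measure $\mu$; $\Omega$ is the set of clopen subsets of ${}^\omega2$. For $\bar c=\langle c_w:w\in W\rangle\in{}^W\Omega$ let $N(\bar c)=\{x:\{w:x\in c_w\}\text{ is infinite}\}$ and $\overline{\Omega}(W)=\{\bar c\in{}^W\Omega:\mu(N(\bar c))=0\}$. For an ideal $J$ on $W$ let $N_J(\bar c)=\{x\in{}^\omega2:\{w:x\in c_w\}\in J^+\}$, $N^*_J(\bar c)=\{x:\{w:x\in c_w\}\in J^d\}$, $\mathcal{N}_J=\{X\subseteq{}^\omega2:\exists\bar c\in\overline{\Omega}(W)\ X\subseteq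 N_J(\bar c)\}$ and $\mathcal{N}^*_J=\{X:\exists\bar c\in\overline{\Omega}(W)\ X\subseteq N^*_J(\bar c)\}$. For $\varphi:M_2\to M_1$ and $K_2\subseteq\mathcal{P}(M_2)$ let $\varphi^{\to}(K_2)=\{A\subseteq M_1:\varphi^{ -1}(A)\in K_2\}$. For $K_1\subseteq\mathcal{P}(M_1)$, $K_2\subseteq\mathcal{P}(M_2)$: $K_1\leq_{\mathrm{KB}}K_2$ iff there is a finite-to-one $\varphi:M_2\to M_1$ with $K_1\subseteq\varphi^{\to}(K_2)$; $K_1\leq_{\mathrm{RB}}K_2$ iff there is a finite-to-one $\varphi:M_2\to M_1$ with $K_1=\varphi^{\to}(K_2)$; $K_1\leq_{\overline{\mathrm{KB}}}K_2$ iff there is a finite-to-one $\varphi:M_1\to M_2$ with $\varphi^{\to}(K_1)\subseteq K_2$. -}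

module Defs where

open import Data.Nat using (ℕ; zero; suc)
open import Data.Bool using (Bool; true; false; _∧_; _∨_; not; if_then_else_)
open import Data.List using (List; []; _∷_; length)
open import Data.Bool.ListAction using (any)
open import Data.List.Membership.Propositional using (_∈_)
open import Data.Product using (Σ; ∃; _×_; _,_)
open import Data.Empty using (⊥)
open import Relation.Nullary using (¬_)
open import Relation.Binary.PropositionalEquality using (_≡_)
open import Data.Rational using (ℚ; 1ℚ; 0ℚ; ½; _*_; _+_; _≤_)

Cantor : Set
Cantor = ℕ → Bool

_==_ : Bool → Bool → Bool
true  == b = b
false == b = not b

extends : Cantor → List Bool → Bool
extends x []       = true
extends x (b ∷ s)  = (x 0 == b) ∧ extends (λ n → x (suc n)) s

-- A clopen subset of Cantor space is coded by a finite list of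
-- basic cylinders (its union); every clopen set has such a code.
ClopenCode : Set
ClopenCode = List (List Bool)

_∈Ω_ : Cantor → ClopenCode → Bool
x ∈Ω c = any (extends x) c

half^ : ℕ → ℚ
half^ zero    = 1ℚ
half^ (suc n) = ½ * half^ n

μcyl : List Bool → ℚ
μcyl s = half^ (length s)

partialSum : (ℕ → List Bool) → ℕ → ℚ
partialSum σ zero    = 0ℚ
partialSum σ (suc n) = partialSum σ n + μcyl (σ n)

-- S ⊆ ^ω2 has (outer) Lebesgue measure zero: for every k it is covered
-- by countably many cylinders of total measure ≤ 2^{-k}.
Null : (Cantor → Set) → Set
Null S = ∀ (k : ℕ) → Σ (ℕ → List Bool) λ σ →
           (∀ n → partialSum σ n ≤ half^ k)
         × (∀ x → S x → ∃ λ i → extends x (σ i) ≡ true)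

Subset : Set → Set
Subset W = W → Bool

_⊆ᵇ_ : {W : Set} → Subset W → Subset W → Set
A ⊆ᵇ B = ∀ w → A w ≡ true → B w ≡ true

FiniteSet : {W : Set} → Subset W → Set
FiniteSet {W} A = Σ (List W) λ l → ∀ w → A w ≡ true → w ∈ l

InfiniteSet : {W : Set} → Subset W → Set
InfiniteSet A = ¬ FiniteSet A

Family : Set → Set₁
Family W = Subset W → Set

record IsIdeal {W : Set} (J : Family W) : Set₁ where
  field
    downward : ∀ A B → A ⊆ᵇ B → J B → J A
    union    : ∀ A B → J A → J B → J (λ w → A w ∨ B w)
    finite   : ∀ A → FiniteSet A → J A
    proper   : ¬ J (λ _ → true)

_∈⁺_ : {W : Set} → Subset W → Family W → Set
A ∈⁺ J = ¬ J A

_∈ᵈ_ : {W : Set} → Subset W → Family W → Set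
A ∈ᵈ J = Σ _ λ a → J a × (∀ w → A w ≡ not (a w))

hits : {W : Set} → (W → ClopenCode) → Cantor → Subset W
hits c x w = x ∈Ω c w

N : {W : Set} → (W → ClopenCode) → Cantor → Set
N c x = InfiniteSet (hits c x)

Ω̄ : {W : Set} → (W → ClopenCode) → Set
Ω̄ c = Null (N c)

NJ : {W : Set} → Family W → (W → ClopenCode) → Cantor → Set
NJ J c x = hits c x ∈⁺ J

N* : {W : Set} → Family W → (W → ClopenCode) → Cantor → Set
N* J c x = hits c x ∈ᵈ J

𝒩 : {W : Set} → Family W → (Cantor → Set) → Set
𝒩 {W} J X = Σ (W → ClopenCode) λ c → Ω̄ c × (∀ x → X x → NJ J c x)

𝒩* : {W : Set} → Family W → (Cantor → Set) → Set
𝒩* {W} J X = Σ (W → ClopenCode) λ c → Ω̄ c × (∀ x → X x → N* J c x)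

_⊑_ : ((Cantor → Set) → Set) → ((Cantor → Set) → Set) → Set₁
𝒜 ⊑ ℬ = ∀ X → 𝒜 X → ℬ X

FiniteToOne : {A B : Set} → (A → B) → Set
FiniteToOne {A} {B} φ = ∀ (b : B) → Σ (List A) λ l → ∀ a → φ a ≡ b → a ∈ l

_⃗ : {M₁ M₂ : Set} → (M₂ → M₁) → Family M₂ → Family M₁
(φ ⃗) K₂ A = K₂ (λ m → A (φ m))

_≤KB_ : {M₁ M₂ : Set} → Family M₁ → Family M₂ → Set
_≤KB_ {M₁} {M₂} K₁ K₂ = Σ (M₂ → M₁) λ φ → FiniteToOne φ ×
                          (∀ A → K₁ A → (φ ⃗) K₂ A)

_≤RB_ : {M₁ M₂ : Set} → Family M₁ → Family M₂ → Set
_≤RB_ {M₁} {M₂} K₁ K₂ = Σ (M₂ → M₁) λ φ → FiniteToOne φ ×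
                          (∀ A → (K₁ A → (φ ⃗) K₂ A) × ((φ ⃗) K₂ A → K₁ A))

_≤KB‾_ : {M₁ M₂ : Set} → Family M₁ → Family M₂ → Set
_≤KB‾_ {M₁} {M₂} K₁ K₂ = Σ (M₁ → M₂) λ φ → FiniteToOne φ ×
                          (∀ A → (φ ⃗) K₁ A → K₂ A)

{-# OPTIONS --safe #-}
module Submission where

open import Defs
open import Data.Nat using (ℕ)
open import Data.Nat.Properties using (eq?)
open import Data.Product using (∃; _×_; _,_; proj₁; proj₂)
open import Data.Bool using (true; false; not)
open import Data.Bool.Properties using (T-≡; not-involutive)
open import Data.List using (List; map; filter; concatMap)
open import Data.List.Relation.Unary.Any as Any using (Any)
open import Data.List.Relation.Unary.Any.Properties using (any⁺; any⁻; concatMap⁺; concatMap⁻)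
open import Data.List.Membership.Propositional using (_∈_; find; lose)
open import Data.List.Membership.Propositional.Properties using (∈-concatMap⁺; ∈-filter⁺; ∈-filter⁻; ∈-map⁺)
open import Function using (_∘_; _↔_; Equivalence)
open import Function.Properties.Inverse using (↔⇒↣)
open import Relation.Binary.Definitions using (DecidableEquality)
open import Relation.Binary.PropositionalEquality using (_≡_; refl; sym; trans; cong; subst)

-- A witness c̄ is moved along the finite-to-one map φ either by pulling
-- back, c̄ ∘ φ, or by pushing forward, taking at w the union of the c_a over
-- the fibre φ⁻¹(w). Because φ is finite-to-one, a point that lies in only
-- finitely many sets of c̄ still does so after the move, which therefore
-- stays in Ω̄. Hit sets are moved by φ-preimage (exactly for the pullback, up
-- to inclusion for the pushforward), and the Katětov–Blass hypothesis together
-- with downward closure of the ideal transfers membership in J^d and J⁺.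
-- Countability of the index sets is used only to decide equality when
-- computing fibres.

⊆ᵇ-complement : {W : Set} {A B : Subset W} → (not ∘ A) ⊆ᵇ B → (not ∘ B) ⊆ᵇ A
⊆ᵇ-complement {A = A} A∁⊆B w ¬Bw with A w in Aw
... | true  = refl
... | false = trans (sym (cong not (A∁⊆B w (cong not Aw)))) ¬Bw

Null-⊆ : {S S′ : Cantor → Set} → (∀ x → S′ x → S x) → Null S → Null S′
Null-⊆ S′⊆S S-null k =
  let σ , small , covers = S-null k in σ , small , λ x → covers x ∘ S′⊆S x

Ω̄-transfer : {W W′ : Set} {c : W → ClopenCode} {c′ : W′ → ClopenCode} →
  (∀ x → FiniteSet (hits c x) → FiniteSet (hits c′ x)) → Ω̄ c → Ω̄ c′
Ω̄-transfer finite⇒finite = Null-⊆ λ x c-cofinite → c-cofinite ∘ finite⇒finite x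

∈Ω-concatMap⁺ : {A : Set} (c : A → ClopenCode) {as : List A} (x : Cantor) →
  Any (λ a → x ∈Ω c a ≡ true) as → x ∈Ω concatMap c as ≡ true
∈Ω-concatMap⁺ c x =
  Equivalence.to T-≡ ∘ any⁺ _ ∘ concatMap⁺ c ∘ Any.map (any⁻ _ _ ∘ Equivalence.from T-≡)

∈Ω-concatMap⁻ : {A : Set} (c : A → ClopenCode) {as : List A} (x : Cantor) →
  x ∈Ω concatMap c as ≡ true → Any (λ a → x ∈Ω c a ≡ true) as
∈Ω-concatMap⁻ c x =
  Any.map (Equivalence.to T-≡ ∘ any⁺ _) ∘ concatMap⁻ c ∘ any⁻ _ _ ∘ Equivalence.from T-≡

module Pullback {W₁ W₂ : Set} {φ : W₁ → W₂} (φ-finite-to-one : FiniteToOne φ) where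

  FiniteSet-preimage : {A : Subset W₂} → FiniteSet A → FiniteSet (A ∘ φ)
  FiniteSet-preimage (l , A⊆l) =
    concatMap (proj₁ ∘ φ-finite-to-one) l ,
    λ w Aφw → ∈-concatMap⁺ (proj₁ ∘ φ-finite-to-one) (lose (A⊆l (φ w) Aφw) (proj₂ (φ-finite-to-one (φ w)) w refl))

  Ω̄-∘ : (c : W₂ → ClopenCode) → Ω̄ c → Ω̄ (c ∘ φ)
  Ω̄-∘ c = Ω̄-transfer {c = c} {c′ = c ∘ φ} λ _ → FiniteSet-preimage

module Pushforward {W₁ W₂ : Set} (_≟_ : DecidableEquality W₂)
                   {φ : W₁ → W₂} (φ-finite-to-one : FiniteToOne φ) where

  fibre : W₂ → List W₁
  fibre w = filter (λ a → φ a ≟ w) (proj₁ (φ-finite-to-one w))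

  ∈-fibre : ∀ a → a ∈ fibre (φ a)
  ∈-fibre a = ∈-filter⁺ (λ a′ → φ a′ ≟ φ a) (proj₂ (φ-finite-to-one (φ a)) a refl) refl

  fibre-sound : ∀ {a w} → a ∈ fibre w → φ a ≡ w
  fibre-sound {w = w} = proj₂ ∘ ∈-filter⁻ (λ a → φ a ≟ w) {xs = proj₁ (φ-finite-to-one w)}

  push : (W₁ → ClopenCode) → W₂ → ClopenCode
  push c w = concatMap c (fibre w)

  module _ (c : W₁ → ClopenCode) (x : Cantor) where

    hits-push⁺ : ∀ a → hits c x a ≡ true → hits (push c) x (φ a) ≡ true
    hits-push⁺ a x∈c = ∈Ω-concatMap⁺ c x (lose (∈-fibre a) x∈c)

    hits-push⁻ : ∀ w → hits (push c) x w ≡ true → ∃ λ a → φ a ≡ w × hits c x a ≡ true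
    hits-push⁻ w x∈push =
      let a , a∈fibre , x∈c = find (∈Ω-concatMap⁻ c x x∈push) in a , fibre-sound a∈fibre , x∈c

    FiniteSet-hits-push : FiniteSet (hits c x) → FiniteSet (hits (push c) x)
    FiniteSet-hits-push (l , hits⊆l) = map φ l , λ w x∈push →
      let a , φa≡w , x∈c = hits-push⁻ w x∈push
      in subst (_∈ map φ l) φa≡w (∈-map⁺ φ (hits⊆l a x∈c))

  Ω̄-push : (c : W₁ → ClopenCode) → Ω̄ c → Ω̄ (push c)
  Ω̄-push c = Ω̄-transfer {c = c} {c′ = push c} (FiniteSet-hits-push c)

module _ {W₁ W₂ : Set} (L : Family W₂) (I : Family W₁) where

  𝒩*-mono-≤KB : L ≤KB I → 𝒩* L ⊑ 𝒩* I
  𝒩*-mono-≤KB (φ , φ-fin , L⊆φI) X (c , c∈Ω̄ , X⊆N*) =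
    c ∘ φ , Pullback.Ω̄-∘ φ-fin c c∈Ω̄ ,
    λ x Xx → let a , La , hits≡∁a = X⊆N* x Xx in a ∘ φ , L⊆φI a La , hits≡∁a ∘ φ

  𝒩-antimono-≤KB : IsIdeal I → DecidableEquality W₂ → L ≤KB I → 𝒩 I ⊑ 𝒩 L
  𝒩-antimono-≤KB I-ideal _≟_ (φ , φ-fin , L⊆φI) X (c , c∈Ω̄ , X⊆NI) =
    push c , Ω̄-push c c∈Ω̄ ,
    λ x Xx L-hits → X⊆NI x Xx
      (IsIdeal.downward I-ideal _ _ (hits-push⁺ c x) (L⊆φI _ L-hits))
    where open Pushforward _≟_ φ-fin

module _ {W₁ W₂ : Set} (L : Family W₁) (I : Family W₂) where

  𝒩*-mono-≤KB‾ : IsIdeal L → DecidableEquality W₂ → L ≤KB‾ I → 𝒩* L ⊑ 𝒩* I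
  𝒩*-mono-≤KB‾ L-ideal _≟_ (φ , φ-fin , φL⊆I) X (c , c∈Ω̄ , X⊆N*) =
    push c , Ω̄-push c c∈Ω̄ ,
    λ x Xx → let a , La , hits≡∁a = X⊆N* x Xx in
      not ∘ hits (push c) x ,
      φL⊆I _ (IsIdeal.downward L-ideal _ a
        (⊆ᵇ-complement λ w ∁aw → hits-push⁺ c x w (trans (hits≡∁a w) ∁aw)) La) ,
      λ w → sym (not-involutive _)
    where open Pushforward _≟_ φ-fin

  𝒩-antimono-≤KB‾ : L ≤KB‾ I → 𝒩 I ⊑ 𝒩 L
  𝒩-antimono-≤KB‾ (φ , φ-fin , φL⊆I) X (c , c∈Ω̄ , X⊆NI) =
    c ∘ φ , Pullback.Ω̄-∘ φ-fin c c∈Ω̄ , λ x Xx L-hits → X⊆NI x Xx (φL⊆I _ L-hits)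

module _ {W₁ W₂ : Set} (L : Family W₂) (I : Family W₁) where

  ≤RB⇒≤KB : L ≤RB I → L ≤KB I
  ≤RB⇒≤KB (φ , φ-fin , L⇔φI) = φ , φ-fin , λ A → proj₁ (L⇔φI A)

  ≤RB⇒≥KB‾ : L ≤RB I → I ≤KB‾ L
  ≤RB⇒≥KB‾ (φ , φ-fin , L⇔φI) = φ , φ-fin , λ A → proj₂ (L⇔φI A)

theorem2p15 : (ℕ₁ ℕ₂ : Set) → ℕ₁ ↔ ℕ → ℕ₂ ↔ ℕ →
    (J : Family ℕ₁) → IsIdeal J → (K : Family ℕ₂) → IsIdeal K →
      (K ≤KB J → (𝒩* K ⊑ 𝒩* J) × (𝒩 J ⊑ 𝒩 K))
    × (K ≤KB‾ J → (𝒩* K ⊑ 𝒩* J) × (𝒩 J ⊑ 𝒩 K))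
    × (K ≤RB J → ((𝒩* J ⊑ 𝒩* K) × (𝒩* K ⊑ 𝒩* J)) × ((𝒩 J ⊑ 𝒩 K) × (𝒩 K ⊑ 𝒩 J)))
theorem2p15 ℕ₁ ℕ₂ ℕ₁↔ℕ ℕ₂↔ℕ J J-ideal K K-ideal =
    (λ K≤J → 𝒩*-mono-≤KB K J K≤J , 𝒩-antimono-≤KB K J J-ideal _≟₂_ K≤J)
  , (λ K≤J → 𝒩*-mono-≤KB‾ K J K-ideal _≟₁_ K≤J , 𝒩-antimono-≤KB‾ K J K≤J)
  , λ K≡J →
      let K≤J = ≤RB⇒≤KB K J K≡J
          J≤K = ≤RB⇒≥KB‾ K J K≡J
      in (𝒩*-mono-≤KB‾ J K J-ideal _≟₂_ J≤K , 𝒩*-mono-≤KB K J K≤J)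
       , (𝒩-antimono-≤KB K J J-ideal _≟₂_ K≤J , 𝒩-antimono-≤KB‾ J K J≤K)
  where
  _≟₁_ : DecidableEquality ℕ₁
  _≟₁_ = eq? (↔⇒↣ ℕ₁↔ℕ)
  _≟₂_ : DecidableEquality ℕ₂
  _≟₂_ = eq? (↔⇒↣ ℕ₂↔ℕ)
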